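{- Fix an integer $t>1$. Let $G$ be a graph of order $n$ whose edges are coloured with three colours so that every vertex is incident to edges of all three colours and there is no monochromatic component of order at least $\frac n2$. Let $G'$ be the (coloured) $t$-blow-up of $G$. Then $G'$ has no monochromatic component of order at least $\frac12|V(G')|=\frac{tn}{2}$, and $\delta(G')=t\delta(G)+t-1$.
   Context: $\delta(G)$ denotes the minimum degree. For an edge-colouring, a monochromatic component of a given colour is a connected component of the graph formed by the edges of that colour (on the vertices incident with such edges); its order is its number of vertices. The $t$-blow-up $G'$ of $G$ is obtained by replacing each vertex $v$ of $G$ by a copy $V_v$ of $K_t$ (vertex sets pairwise disjoint) and each edge $uv$ of $G$ by a complete bipartite graph $K_{t,t}$ between $V_u$ and $V_v$. Given a 3-edge-colouring of $G$, the edges of $G'$ between $V_u$ and $V_v$ receive the colour of $uv$ in $G$, and the edges inside each $V_v$ are coloured arbitrarily with the three colours. -}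

module Defs where

open import Data.Nat using (ℕ; zero; suc; _+_; _*_; _∸_; _≤_)
open import Data.Fin using (Fin; quotient)
open import Data.Maybe using (Maybe; just; nothing; is-just)
open import Data.Bool using (if_then_else_)
open import Data.List using (List; length; map; allFin)
open import Data.Nat.ListAction using (sum)
open import Data.List.Relation.Unary.All using (All)
open import Data.List.Relation.Unary.Unique.Propositional using (Unique)
open import Data.Product using (Σ; ∃; ∃-syntax; _×_; _,_)
open import Relation.Binary.PropositionalEquality using (_≡_; _≢_)
open import Relation.Binary.Construct.Closure.ReflexiveTransitive using (Star)
open import Relation.Nullary using (¬_)

Colour : Set
Colour = Fin 3

-- A finite simple graph on vertex set Fin n together with a 3-edge-colouring:
-- col u v = just c  iff  uv is an edge of colour c;  col u v = nothing iff uv is a non-edge.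
record ColouredGraph (n : ℕ) : Set where
  field
    col    : Fin n → Fin n → Maybe Colour
    sym    : ∀ u v → col u v ≡ col v u
    irrefl : ∀ v → col v v ≡ nothing
open ColouredGraph public

module _ {n : ℕ} (G : ColouredGraph n) where

  Adj : Colour → Fin n → Fin n → Set
  Adj c u v = col G u v ≡ just c

  Incident : Colour → Fin n → Set
  Incident c v = ∃[ w ] Adj c v w

  AllColoursAtEveryVertex : Set
  AllColoursAtEveryVertex = ∀ v c → Incident c v

  Reach : Colour → Fin n → Fin n → Set
  Reach c = Star (Adj c)

  -- there is a monochromatic component (of some colour c, i.e. a connected
  -- component of the graph of colour-c edges on the vertices incident with
  -- colour-c edges) of order at least n/2: some vertex v incident with colour c
  -- and a list S of distinct vertices, all in the colour-c component of v,
  -- with 2|S| ≥ n.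
  -- has a monochromatic component of order at least half of n  (2|C| ≥ n)
  HasMonoComponentOfHalfOrder : Set
  HasMonoComponentOfHalfOrder =
    ∃[ c ] ∃[ v ] Incident c v ×
      (∃[ S ] Unique S × All (Reach c v) S × n ≤ 2 * length S)

  degree : Fin n → ℕ
  degree v = sum (map (λ w → if is-just (col G v w) then 1 else 0) (allFin n))

  IsMinDegree : ℕ → Set
  IsMinDegree d = (∃[ v ] degree v ≡ d) × (∀ v → d ≤ degree v)

-- H (on vertex set Fin (n * t), vertex x belonging to the part V_{quotient t x})
-- is a coloured t-blow-up of G: edges between distinct parts V_u, V_v carry
-- exactly the colour (or absence) of uv in G; each part V_v is a complete graph
-- K_t whose edges are coloured arbitrarily.
IsColouredBlowUp : {n : ℕ} (t : ℕ) → ColouredGraph n → ColouredGraph (n * t) → Set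
IsColouredBlowUp {n} t G H =
  (∀ x y → quotient {n} t x ≢ quotient {n} t y →
     col H x y ≡ col G (quotient {n} t x) (quotient {n} t y)) ×
  (∀ x y → quotient {n} t x ≡ quotient {n} t y → x ≢ y → col H x y ≢ nothing)

module Submission where

-- Write part x ∈ V(G) for the part V_u containing a vertex x of the t-blow-up
-- G', and combine u j for the j-th vertex of V_u.
--
-- An edge of G' between different parts V_u, V_w is an edge uw
--   of G of the same colour, and an edge inside a part joins vertices with the
--   same projection; so every monochromatic walk of G' projects to a walk of
--   the same colour in G.  A colour-c component S of G' therefore lies inside
--   the blow-up of the set P of parts it meets, P is inside a colour-c
--   component of G, and |S| ≤ t|P|.  So tn ≤ 2|S| forces n ≤ 2|P|.
-- * Degrees.  The vertex combine u i sees all t vertices of V_w when uw is an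
--   edge of G, none when it is not, and the t - 1 other vertices of its own
--   part; hence its degree is t·deg(u) + (t - 1), and δ(G') = tδ(G) + t - 1.

open import Defs
open import Data.Nat using (ℕ; _+_; _*_; _∸_; _<_)
open import Data.Product using (_×_)
open import Relation.Nullary using (¬_)

open import Data.Nat using (zero; suc; _≤_; z≤n; s≤s; z<s; NonZero; >-nonZero; >-nonZero⁻¹)
open import Data.Nat.Properties
  using (+-comm; +-assoc; *-assoc; *-zeroʳ; *-identityʳ; <-trans; <⇒≤;
         +-monoˡ-≤; *-monoʳ-≤; *-cancelʳ-≤; +-∸-assoc; +-*-semiring; module ≤-Reasoning)
import Data.Nat.ListAction as ListAction
open import Data.Fin as Fin using (Fin; _↑ˡ_; _↑ʳ_; combine; quotient; remainder; punchIn; fromℕ<; _≟_)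
open import Data.Fin.Properties using (remQuot-combine; combine-remQuot; combine-injectiveʳ; punchInᵢ≢i)
open import Data.Maybe using (Maybe; just; nothing; is-just)
open import Data.Bool using (if_then_else_)
open import Data.List using (List; []; _∷_; length; map; tabulate; allFin; filter; _++_; cartesianProductWith)
open import Data.List.Properties using (length-++; length-map; length-tabulate; length-removeAt′)
open import Data.List.Relation.Unary.All as All using (All)
open import Data.List.Relation.Unary.Any using (Any; here; there; index; any?)
open import Data.List.Relation.Unary.AllPairs using (_∷_)
open import Data.List.Relation.Unary.Unique.Propositional using (Unique)
open import Data.List.Relation.Unary.Unique.Propositional.Properties using (allFin⁺; filter⁺)
open import Data.List.Membership.Propositional using (_∈_; _─_; find; lose)
open import Data.List.Membership.Propositional.Properties
  using (∈-filter⁺; ∈-filter⁻; ∈-allFin; ∈-cartesianProductWith⁺)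
open import Data.List.Relation.Binary.Subset.Propositional using (_⊆_)
open import Data.Product using (_,_; proj₁; proj₂)
open import Data.Empty using (⊥-elim)
open import Function using (id; _∘_)
open import Relation.Nullary using (Dec; yes; no)
open import Relation.Binary.PropositionalEquality
  using (_≡_; _≢_; refl; trans; cong; cong₂; subst; module ≡-Reasoning)
import Relation.Binary.PropositionalEquality as Eq
open import Relation.Binary.Construct.Closure.ReflexiveTransitive using (ε; _◅_)
open import Algebra.Properties.Semiring.Sum +-*-semiring
  using (sum-syntax; sum-cong-≗; sum-remove; *-distribˡ-sum)

sum-map-tabulate : ∀ {A : Set} {m} (f : A → ℕ) (g : Fin m → A) →
  ListAction.sum (map f (tabulate g)) ≡ ∑[ i < m ] f (g i)
sum-map-tabulate {m = zero}  f g = refl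
sum-map-tabulate {m = suc m} f g = cong (f (g Fin.zero) +_) (sum-map-tabulate f (g ∘ Fin.suc))

∑-const : ∀ m k → ∑[ i < m ] k ≡ m * k
∑-const zero    k = refl
∑-const (suc m) k = cong (k +_) (∑-const m k)

∑-↑ : ∀ a b (f : Fin (a + b) → ℕ) →
  ∑[ i < a + b ] f i ≡ ∑[ i < a ] f (i ↑ˡ b) + ∑[ j < b ] f (a ↑ʳ j)
∑-↑ zero    b f = refl
∑-↑ (suc a) b f = trans (cong (f _ +_) (∑-↑ a b (f ∘ Fin.suc))) (Eq.sym (+-assoc (f _) _ _))

∑-combine : ∀ n t (f : Fin (n * t) → ℕ) →
  ∑[ x < n * t ] f x ≡ ∑[ u < n ] ∑[ j < t ] f (combine u j)
∑-combine zero    t f = refl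
∑-combine (suc n) t f = trans (∑-↑ t (n * t) f) (cong (∑[ j < t ] f (j ↑ˡ (n * t)) +_) (∑-combine n t (f ∘ (t ↑ʳ_))))

∑-ones-but-one : ∀ m (i : Fin m) (f : Fin m → ℕ) →
  f i ≡ 0 → (∀ j → j ≢ i → f j ≡ 1) → ∑[ j < m ] f j ≡ m ∸ 1
∑-ones-but-one (suc m) i f fi≡0 ones = begin
  ∑[ j < suc m ] f j               ≡⟨ sum-remove {i = i} f ⟩
  f i + ∑[ j < m ] f (punchIn i j) ≡⟨ cong₂ _+_ fi≡0 (sum-cong-≗ λ j → ones _ (punchInᵢ≢i i j)) ⟩
  ∑[ j < m ] 1                     ≡⟨ ∑-const m 1 ⟩
  m * 1                            ≡⟨ *-identityʳ m ⟩
  m                                ∎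
  where open ≡-Reasoning

∑-differ-at : ∀ m (u : Fin m) (f g : Fin m → ℕ) →
  g u ≡ 0 → (∀ w → w ≢ u → f w ≡ g w) → ∑[ w < m ] f w ≡ ∑[ w < m ] g w + f u
∑-differ-at (suc m) u f g gu≡0 agree = begin
  ∑[ w < suc m ] f w                     ≡⟨ sum-remove {i = u} f ⟩
  f u + ∑[ w < m ] f (punchIn u w)       ≡⟨ cong (f u +_) (sum-cong-≗ λ w → agree _ (punchInᵢ≢i u w)) ⟩
  f u + ∑[ w < m ] g (punchIn u w)       ≡⟨ +-comm (f u) _ ⟩
  ∑[ w < m ] g (punchIn u w) + f u       ≡⟨ cong (λ z → z + ∑[ w < m ] g (punchIn u w) + f u) gu≡0 ⟨
  g u + ∑[ w < m ] g (punchIn u w) + f u ≡⟨ cong (_+ f u) (sum-remove {i = u} g) ⟨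
  ∑[ w < suc m ] g w + f u               ∎
  where open ≡-Reasoning

∈-─ : ∀ {A : Set} {x y : A} (L : List A) (x∈L : x ∈ L) → y ∈ L → x ≢ y → y ∈ L ─ x∈L
∈-─ (z ∷ L) (here refl)  (here refl)  x≢y = ⊥-elim (x≢y refl)
∈-─ (z ∷ L) (here _)     (there y∈L)  _   = y∈L
∈-─ (z ∷ L) (there _)    (here y≡z)   _   = here y≡z
∈-─ (z ∷ L) (there x∈L)  (there y∈L)  x≢y = there (∈-─ L x∈L y∈L x≢y)

Unique-⊆⇒length-≤ : ∀ {A : Set} {S L : List A} → Unique S → S ⊆ L → length S ≤ length L
Unique-⊆⇒length-≤ {S = []}             _                  _    = z≤n
Unique-⊆⇒length-≤ {S = x ∷ S} {L} (x≢S ∷ uniqueS) S⊆L = begin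
  suc (length S)         ≤⟨ s≤s (Unique-⊆⇒length-≤ uniqueS S⊆L─x) ⟩
  suc (length (L ─ x∈L)) ≡⟨ length-removeAt′ L (index x∈L) ⟨
  length L               ∎
  where
  open ≤-Reasoning
  x∈L : x ∈ L
  x∈L = S⊆L (here refl)
  S⊆L─x : S ⊆ L ─ x∈L
  S⊆L─x y∈S = ∈-─ L x∈L (S⊆L (there y∈S)) (All.lookup x≢S y∈S)

length-cartesianProductWith : ∀ {A B C : Set} (f : A → B → C) xs ys →
  length (cartesianProductWith f xs ys) ≡ length xs * length ys
length-cartesianProductWith f []       ys = refl
length-cartesianProductWith f (x ∷ xs) ys = begin
  length (map (f x) ys ++ cartesianProductWith f xs ys)            ≡⟨ length-++ (map (f x) ys) ⟩
  length (map (f x) ys) + length (cartesianProductWith f xs ys)    ≡⟨ cong₂ _+_ (length-map (f x) ys)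
                                                                        (length-cartesianProductWith f xs ys) ⟩
  length ys + length xs * length ys                                ∎
  where open ≡-Reasoning

isEdge : Maybe Colour → ℕ
isEdge m = if is-just m then 1 else 0

isEdge-edge : ∀ m → m ≢ nothing → isEdge m ≡ 1
isEdge-edge nothing  m≢nothing = ⊥-elim (m≢nothing refl)
isEdge-edge (just _) _         = refl

degree-∑ : ∀ {m} (H : ColouredGraph m) v → degree H v ≡ ∑[ w < m ] isEdge (col H v w)
degree-∑ H v = sum-map-tabulate (λ w → isEdge (col H v w)) id

module BlowUp {n t : ℕ} (G : ColouredGraph n) (G' : ColouredGraph (n * t))
              (blowUp : IsColouredBlowUp t G G') where

  part : Fin (n * t) → Fin n
  part = quotient {n} t

  position : Fin (n * t) → Fin t
  position = remainder {n} t

  part-combine : ∀ u j → part (combine u j) ≡ u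
  part-combine u j = cong proj₁ (remQuot-combine {n} {t} u j)

  combine-part : ∀ x → combine (part x) (position x) ≡ x
  combine-part = combine-remQuot {n} t

  crossEdge : ∀ {u w} i j → u ≢ w → col G' (combine u i) (combine w j) ≡ col G u w
  crossEdge {u} {w} i j u≢w = begin
    col G' (combine u i) (combine w j)              ≡⟨ proj₁ blowUp _ _ differentParts ⟩
    col G (part (combine u i)) (part (combine w j)) ≡⟨ cong₂ (col G) (part-combine u i) (part-combine w j) ⟩
    col G u w                                       ∎
    where
    open ≡-Reasoning
    differentParts : part (combine u i) ≢ part (combine w j)
    differentParts same = u≢w (trans (Eq.sym (part-combine u i)) (trans same (part-combine w j)))

  innerEdge : ∀ u {i j} → i ≢ j → col G' (combine u i) (combine u j) ≢ nothing
  innerEdge u {i} {j} i≢j = proj₂ blowUp _ _ samePart (i≢j ∘ combine-injectiveʳ u i u j)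
    where
    samePart : part (combine u i) ≡ part (combine u j)
    samePart = trans (part-combine u i) (Eq.sym (part-combine u j))

  -- Every monochromatic walk of G' projects to a walk of the same colour in G:
  -- an edge inside a part is contracted, an edge between parts is an edge of G.
  project-Reach : ∀ {c x y} → Reach G' c x y → Reach G c (part x) (part y)
  project-Reach ε = ε
  project-Reach {c} {x} (_◅_ {j = y} xy rest) with part x ≟ part y
  ... | yes same  = subst (λ z → Reach G c z _) (Eq.sym same) (project-Reach rest)
  ... | no differ = trans (Eq.sym (proj₁ blowUp x y differ)) xy ◅ project-Reach rest

  -- The vertex combine u i has t·deg(u) neighbours in the other parts and is
  -- adjacent to the t - 1 other vertices of its own part.
  degree-blowUp : ∀ u i → degree G' (combine u i) ≡ t * degree G u + (t ∸ 1)
  degree-blowUp u i = begin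
    degree G' x                                    ≡⟨ degree-∑ G' x ⟩
    ∑[ y < n * t ] isEdge (col G' x y)             ≡⟨ ∑-combine n t _ ⟩
    ∑[ w < n ] edgesTo w                           ≡⟨ ∑-differ-at n u edgesTo viaG noLoop edgesTo-other ⟩
    ∑[ w < n ] viaG w + edgesTo u                  ≡⟨ cong₂ _+_ (Eq.sym (*-distribˡ-sum t (λ w → isEdge (col G u w)))) edgesTo-own ⟩
    t * ∑[ w < n ] isEdge (col G u w) + (t ∸ 1)    ≡⟨ cong (λ k → t * k + (t ∸ 1)) (degree-∑ G u) ⟨
    t * degree G u + (t ∸ 1)                       ∎
    where
    open ≡-Reasoning
    x : Fin (n * t)
    x = combine u i
    edgesTo : Fin n → ℕ
    edgesTo w = ∑[ j < t ] isEdge (col G' x (combine w j))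
    viaG : Fin n → ℕ
    viaG w = t * isEdge (col G u w)
    noLoop : viaG u ≡ 0
    noLoop = trans (cong (λ m → t * isEdge m) (irrefl G u)) (*-zeroʳ t)
    edgesTo-other : ∀ w → w ≢ u → edgesTo w ≡ viaG w
    edgesTo-other w w≢u =
      trans (sum-cong-≗ λ j → cong isEdge (crossEdge i j (w≢u ∘ Eq.sym))) (∑-const t _)
    edgesTo-own : edgesTo u ≡ t ∸ 1
    edgesTo-own = ∑-ones-but-one t i _ (cong isEdge (irrefl G' x))
      λ j j≢i → isEdge-edge _ (innerEdge u (j≢i ∘ Eq.sym))

  -- For t ≥ 1, a monochromatic component of G' of order ≥ tn/2 yields one of
  -- G of order ≥ n/2: the parts met by the component.
  halfComponent-project : .{{_ : NonZero t}} → AllColoursAtEveryVertex G →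
    HasMonoComponentOfHalfOrder G' → HasMonoComponentOfHalfOrder G
  halfComponent-project allColours (c , v , _ , S , uniqueS , S-reached , tn≤2|S|) =
    c , part v , allColours (part v) c , parts , filter⁺ meets? (allFin⁺ n) , parts-reached , n≤2|parts|
    where
    meets? : (u : Fin n) → Dec (Any (λ s → part s ≡ u) S)
    meets? u = any? (λ s → part s ≟ u) S
    parts : List (Fin n)
    parts = filter meets? (allFin n)
    parts-reached : All (Reach G c (part v)) parts
    parts-reached = All.tabulate λ u∈parts →
      let (s , s∈S , s↦u) = find (proj₂ (∈-filter⁻ meets? {xs = allFin n} u∈parts))
      in subst (Reach G c (part v)) s↦u (project-Reach (All.lookup S-reached s∈S))
    S⊆blowUpOfParts : S ⊆ cartesianProductWith combine parts (allFin t)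
    S⊆blowUpOfParts {s} s∈S = subst (_∈ _) (combine-part s)
      (∈-cartesianProductWith⁺ combine (∈-filter⁺ meets? (∈-allFin (part s)) (lose s∈S refl)) (∈-allFin _))
    n≤2|parts| : n ≤ 2 * length parts
    n≤2|parts| = *-cancelʳ-≤ n (2 * length parts) t (begin
      n * t                                                  ≤⟨ tn≤2|S| ⟩
      2 * length S                                           ≤⟨ *-monoʳ-≤ 2 (Unique-⊆⇒length-≤ uniqueS S⊆blowUpOfParts) ⟩
      2 * length (cartesianProductWith combine parts (allFin t)) ≡⟨ cong (2 *_) (length-cartesianProductWith combine parts (allFin t)) ⟩
      2 * (length parts * length (allFin t))                 ≡⟨ cong (λ k → 2 * (length parts * k)) (length-tabulate id) ⟩
      2 * (length parts * t)                                 ≡⟨ *-assoc 2 (length parts) t ⟨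
      2 * length parts * t                                   ∎)
      where open ≤-Reasoning

  -- For t ≥ 1, δ(G') = t·δ(G) + (t - 1), attained in the part of a vertex of minimum degree.
  minDegree-blowUp : .{{_ : NonZero t}} → ∀ d → IsMinDegree G d → IsMinDegree G' (t * d + (t ∸ 1))
  minDegree-blowUp d ((v , deg-v≡d) , minimal) = (combine v firstPosition , attained) , bounded
    where
    firstPosition : Fin t
    firstPosition = fromℕ< (>-nonZero⁻¹ t)
    attained : degree G' (combine v firstPosition) ≡ t * d + (t ∸ 1)
    attained = trans (degree-blowUp v firstPosition) (cong (λ k → t * k + (t ∸ 1)) deg-v≡d)
    bounded : ∀ x → t * d + (t ∸ 1) ≤ degree G' x
    bounded x = begin
      t * d + (t ∸ 1)                                ≤⟨ +-monoˡ-≤ (t ∸ 1) (*-monoʳ-≤ t (minimal (part x))) ⟩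
      t * degree G (part x) + (t ∸ 1)                ≡⟨ degree-blowUp (part x) (position x) ⟨
      degree G' (combine (part x) (position x))      ≡⟨ cong (degree G') (combine-part x) ⟩
      degree G' x                                    ∎
      where open ≤-Reasoning

lemma3p2 : (t : ℕ) → 1 < t → (n : ℕ) → (G : ColouredGraph n) →
    AllColoursAtEveryVertex G →
    ¬ HasMonoComponentOfHalfOrder G →
    (G' : ColouredGraph (n * t)) → IsColouredBlowUp t G G' →
    ¬ HasMonoComponentOfHalfOrder G' ×
      ((d : ℕ) → IsMinDegree G d → IsMinDegree G' (t * d + t ∸ 1))
lemma3p2 t 1<t n G allColours noHalfComponent G' blowUp =
  noHalfComponent ∘ halfComponent-project allColours , minDegree
  where
  open BlowUp G G' blowUp
  instance
    t≢0 : NonZero t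
    t≢0 = >-nonZero (<-trans z<s 1<t)
  minDegree : (d : ℕ) → IsMinDegree G d → IsMinDegree G' (t * d + t ∸ 1)
  minDegree d isMin =
    subst (IsMinDegree G') (Eq.sym (+-∸-assoc (t * d) (<⇒≤ 1<t))) (minDegree-blowUp d isMin)
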